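{- Let $\mathcal{A}$ be a linearly ordered alphabet of cardinality $3$. For every integer $n \geqslant 3$, there exists a word $w \in \mathcal{A}^{5 \times 2^n-3}$ on which the IS-algorithm performs $n$ recursive calls, and such that \[|\mathsf{is}^k(w)|+1 = 2^{2-k} (|w|+3) / 5\] for all $k \in \{1,2,\ldots,n\}$.
   Context: Words are indexed from $0$: $w = w_0 \cdots w_{|w|-1}$, and $w_{i \cdots j} = w_i \cdots w_j$. A sentinel letter $\$ \notin \mathcal{A}$ is smaller than every letter of $\mathcal{A}$, and $w_{|w|} = \$$. An integer $i \leqslant |w|-1$ is $w$-non-decreasing if there is $j$ with $i+1 \leqslant j \leqslant |w|-1$ and $w_i = \cdots = w_{j-1} < w_j$; it is $w$-locally minimal if moreover $i \geqslant 1$ and $w_{i-1} > w_i$. If $i_0 < \cdots < i_{k-1}$ are the $w$-locally minimal integers and $i_k = |w|$, the unimodal factors of $w$ are $w_{i_0 \cdots i_1}, \ldots, w_{i_{k-1} \cdots i_k}$; $\mathsf{eis}(w)$ is the length-$k$ word over the lexicographically ordered alphabet $\mathcal{A}^+\cdot(\varepsilon+\$)$ whose letters are these factors in order; $\mathsf{is}(w)$ is obtained from $\mathsf{eis}(w)$ by replacing each letter by its rank (from $0$) among the distinct letters of $\mathsf{eis}(w)$; $\mathsf{is}^0(w)=w$, $\mathsf{is}^{k+1}(w) = \mathsf{is}(\mathsf{is}^k(w))$. The IS-algorithm computes the suffix array of its input word $v$ by computing $\mathsf{is}(v)$ and then computing the suffix array of $\mathsf{is}(v)$, directly if the letters of $\mathsf{is}(v)$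 are pairwise distinct, and by a recursive call of the IS-algorithm on $\mathsf{is}(v)$ otherwise. -}

module Defs where

open import Data.Nat using (ℕ; zero; suc; _+_; _*_; _∸_; _^_; _≤_; _<_; _<ᵇ_; _≡ᵇ_; _≤ᵇ_)
open import Data.Bool using (Bool; true; false; _∧_; _∨_; not; T)
open import Data.List using (List; []; _∷_; _++_; length; map; upTo; filterᵇ; deduplicateᵇ; take; drop)
open import Data.Bool.ListAction using (any; all)
open import Data.List.Relation.Unary.Unique.Propositional using (Unique)
open import Data.Product using (_×_; _,_)
open import Relation.Nullary using (¬_)

-- Words are lists of natural numbers (letters compared by the usual order on ℕ).
-- The alphabet of cardinality 3 is {0,1,2} with its natural order.

-- Letter at position i of w, with default 0 outside the word
-- (only ever used at positions i < |w|).
at : List ℕ → ℕ → ℕ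
at []       _       = 0
at (x ∷ _)  zero    = x
at (_ ∷ xs) (suc i) = at xs i

range : ℕ → ℕ → List ℕ
range i j = map (i +_) (upTo (j ∸ i))

allEqOn : List ℕ → ℕ → ℕ → Bool
allEqOn w i j = all (λ m → at w m ≡ᵇ at w i) (range i j)

nonDecreasing : List ℕ → ℕ → Bool
nonDecreasing w i =
  (i <ᵇ length w) ∧
  any (λ j → ((i + 1) ≤ᵇ j) ∧ (allEqOn w i j ∧ (at w i <ᵇ at w j))) (upTo (length w))

locallyMinimal : List ℕ → ℕ → Bool
locallyMinimal w i = nonDecreasing w i ∧ ((1 ≤ᵇ i) ∧ (at w i <ᵇ at w (i ∸ 1)))

lmPositions : List ℕ → List ℕ
lmPositions w = filterᵇ (locallyMinimal w) (upTo (length w))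

-- Words over A ∪ {$}: a letter a of A is encoded as suc a, the sentinel $ as 0,
-- so $ is smaller than every letter.  ext w = w_0 ... w_{|w|-1} w_{|w|} with w_{|w|} = $.
ext : List ℕ → List ℕ
ext w = map suc w ++ (0 ∷ [])

factor : List ℕ → ℕ → ℕ → List ℕ
factor w i j = take (suc j ∸ i) (drop i (ext w))

bounds : List ℕ → ℕ → List (ℕ × ℕ)
bounds []            n = []
bounds (i ∷ [])      n = (i , n) ∷ []
bounds (i ∷ j ∷ ps)  n = (i , j) ∷ bounds (j ∷ ps) n

eis : List ℕ → List (List ℕ)
eis w = map (λ p → factor w (Data.Product.proj₁ p) (Data.Product.proj₂ p))
            (bounds (lmPositions w) (length w))

eqᵇ : List ℕ → List ℕ → Bool
eqᵇ []       []       = true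
eqᵇ []       (_ ∷ _)  = false
eqᵇ (_ ∷ _)  []       = false
eqᵇ (x ∷ xs) (y ∷ ys) = (x ≡ᵇ y) ∧ eqᵇ xs ys

lexLtᵇ : List ℕ → List ℕ → Bool
lexLtᵇ []       []       = false
lexLtᵇ []       (_ ∷ _)  = true
lexLtᵇ (_ ∷ _)  []       = false
lexLtᵇ (x ∷ xs) (y ∷ ys) = (x <ᵇ y) ∨ ((x ≡ᵇ y) ∧ lexLtᵇ xs ys)

rank : List (List ℕ) → List ℕ → ℕ
rank us u = length (deduplicateᵇ eqᵇ (filterᵇ (λ v → lexLtᵇ v u) us))

is : List ℕ → List ℕ
is w = map (rank (eis w)) (eis w)

is^ : ℕ → List ℕ → List ℕ
is^ zero    w = w
is^ (suc k) w = is (is^ k w)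

-- The IS-algorithm run on w performs exactly n recursive calls:
-- the i-th recursive call (i ≥ 1) is made on is^i(w), which happens iff
-- is^1(w), ..., is^i(w) all have a repeated letter; the run stops after
-- computing is^{n+1}(w) iff that word has pairwise distinct letters.
ISRecursiveCalls : List ℕ → ℕ → Set
ISRecursiveCalls w n =
  Unique (is^ (suc n) w) × (∀ k → k < n → ¬ Unique (is^ (suc k) w))

{-# OPTIONS --safe #-}
-- The witness is built backwards.  Let lift u be 1 followed by u with every letter c replaced by 0 (c+1).
-- If u ends with its largest letter a, which occurs nowhere else, and every smaller letter occurs in u,
-- then the locally minimal positions of lift u are exactly its 0's, so its unimodal factors are
-- 0 (c+1) 0 for the letters c of u before the last one and 0 (a+1) $ for the last; they are ordered
-- like the letters themselves, hence is (lift u) = u.  Iterating lift from 0 0 1 gives a tower of words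
-- that all repeat a letter, with |lift u| + 1 = 2 (|u| + 1), while is (0 0 1) is empty.  The top of the
-- tower is finally recoded over {0,1,2} by 0 ↦ 0 2 and c+1 ↦ 1 2^(c+1) behind 2 2, and the same factor
-- analysis shows that is undoes this recoding.
module Submission where

open import Data.Bool using (Bool; true; false; _∧_; _∨_; not; T; T?; if_then_else_)
open import Data.Bool.ListAction using (any; and; or)
open import Data.Bool.Properties using (∧-zeroʳ; ∧-identityʳ; ∨-identityʳ; T-≡)
open import Data.List
  using (List; []; _∷_; _++_; length; map; upTo; filter; filterᵇ; deduplicate; deduplicateᵇ; take; replicate; head; concatMap)
open import Data.List.Membership.Propositional using (_∈_)
open import Data.List.Membership.Propositional.Properties
  using (∈-++⁺ˡ; ∈-++⁺ʳ; ∈-filter⁺; ∈-filter⁻; deduplicate-∈⇔; ∈-upTo⁺; ∈-upTo⁻)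
open import Data.List.Membership.Propositional.Properties.WithK using (unique∧set⇒bag)
open import Data.List.Properties
  using (++-assoc; ++-identityʳ; concatMap-++; filter-++; filter-all; length-++; length-map; length-replicate; length-upTo;
         map-++; map-cong; map-cong-local; map-id; map-upTo; map-∘)
open import Data.List.Relation.Binary.BagAndSetEquality using (∼bag⇒↭)
open import Data.List.Relation.Binary.Permutation.Propositional.Properties using (↭-length)
open import Data.List.Relation.Unary.All using (All; []; _∷_)
import Data.List.Relation.Unary.All as All
import Data.List.Relation.Unary.All.Properties as All
open import Data.List.Relation.Unary.AllPairs using ([]; _∷_)
open import Data.List.Relation.Unary.Any using (here; there)
open import Data.List.Relation.Unary.Linked using (Linked; []; [-]; _∷_)
open import Data.List.Relation.Unary.Unique.Propositional using (Unique)
open import Data.List.Relation.Unary.Unique.Propositional.Properties using (upTo⁺)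
open import Data.Maybe using (fromMaybe)
open import Data.Nat using (ℕ; zero; suc; _+_; _*_; _∸_; _^_; _≤_; _<_; _<ᵇ_; _≡ᵇ_; _≤ᵇ_; z≤n; s≤s; _≟_; _<?_)
open import Data.Nat.ListAction using (sum)
open import Data.Nat.Properties
  using (≤-refl; <⇒≤; <⇒≢; >⇒≢; <-trans; <⇒<ᵇ; ≡⇒≡ᵇ; ≡ᵇ⇒≡;
         +-suc; *-suc; *-assoc; ^-distribˡ-+-*; m+[n∸m]≡n; n∸n≡0; m+n∸n≡m)
open import Data.Nat.Tactic.RingSolver using (solve-∀)
open import Data.List.Relation.Unary.Unique.DecPropositional.Properties _≟_ using (deduplicate-!)
open import Data.Product using (Σ; ∃; _×_; _,_; proj₂; uncurry)
import Data.Product as Product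
open import Data.Unit using (⊤; tt)
open import Function using (_∘_; id)
open import Function.Bundles using (Equivalence; mk⇔)
open import Relation.Binary.PropositionalEquality
open import Relation.Nullary using (¬_; Dec; does; ¬?; contradiction)
open import Relation.Unary using (Decidable)

open import Defs

<ᵇ-true : ∀ {m n} → m < n → (m <ᵇ n) ≡ true
<ᵇ-true m<n = Equivalence.to T-≡ (<⇒<ᵇ m<n)

<ᵇ-false : ∀ {m n} → n ≤ m → (m <ᵇ n) ≡ false
<ᵇ-false {m}     {zero}  _         = refl
<ᵇ-false {suc m} {suc n} (s≤s n≤m) = <ᵇ-false n≤m

≡ᵇ-refl : ∀ n → (n ≡ᵇ n) ≡ true
≡ᵇ-refl n = Equivalence.to T-≡ (≡⇒≡ᵇ n n refl)

≢⇒≡ᵇ-false : ∀ {m n} → m ≢ n → (m ≡ᵇ n) ≡ false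
≢⇒≡ᵇ-false {m} {n} m≢n with m ≡ᵇ n in eq
... | true  = contradiction (≡ᵇ⇒≡ m n (subst T (sym eq) tt)) m≢n
... | false = refl

≤ᵇ-suc : ∀ m n → (suc m ≤ᵇ suc n) ≡ (m ≤ᵇ n)
≤ᵇ-suc zero    n = refl
≤ᵇ-suc (suc m) n = refl

∨-∧-falseʳ : ∀ b c → (b ∨ (c ∧ false)) ≡ b
∨-∧-falseʳ b c rewrite ∧-zeroʳ c = ∨-identityʳ b

upTo-suc : ∀ n → upTo (suc n) ≡ 0 ∷ map suc (upTo n)
upTo-suc n = cong (0 ∷_) (sym (map-upTo suc n))

consIf : {A : Set} → Bool → A → List A → List A
consIf b x xs = if b then x ∷ xs else xs

filterᵇ-∷ : {A : Set} (p : A → Bool) (x : A) (xs : List A) → filterᵇ p (x ∷ xs) ≡ consIf (p x) x (filterᵇ p xs)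
filterᵇ-∷ p x xs with p x
... | true  = refl
... | false = refl

module _ {A B : Set} {P : A → Set} {Q : B → Set} (P? : Decidable P) (Q? : Decidable Q) (f : A → B)
         (agree : ∀ x → does (Q? (f x)) ≡ does (P? x)) where

  filter-map : ∀ xs → filter Q? (map f xs) ≡ map f (filter P? xs)
  filter-map []       = refl
  filter-map (x ∷ xs) with does (Q? (f x)) | does (P? x) | agree x
  ... | true  | true  | refl = cong (f x ∷_) (filter-map xs)
  ... | false | false | refl = filter-map xs

module _ {A B : Set} {R : A → A → Set} {S : B → B → Set}
         (R? : ∀ x y → Dec (R x y)) (S? : ∀ x y → Dec (S x y)) (f : A → B)
         (agree : ∀ x y → does (S? (f x) (f y)) ≡ does (R? x y)) where

  deduplicate-map : ∀ xs → deduplicate S? (map f xs) ≡ map f (deduplicate R? xs)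
  deduplicate-map []       = refl
  deduplicate-map (x ∷ xs) = cong (f x ∷_) (begin
      filter (¬? ∘ S? (f x)) (deduplicate S? (map f xs))
    ≡⟨ cong (filter (¬? ∘ S? (f x))) (deduplicate-map xs) ⟩
      filter (¬? ∘ S? (f x)) (map f (deduplicate R? xs))
    ≡⟨ filter-map (¬? ∘ R? x) (¬? ∘ S? (f x)) f (cong not ∘ agree x) (deduplicate R? xs) ⟩
      map f (filter (¬? ∘ R? x) (deduplicate R? xs))
    ∎)
    where open ≡-Reasoning

filter-cong : {A : Set} {P Q : A → Set} (P? : Decidable P) (Q? : Decidable Q) →
              (∀ x → does (Q? x) ≡ does (P? x)) → ∀ xs → filter Q? xs ≡ filter P? xs
filter-cong P? Q? agree xs =
  trans (cong (filter Q?) (sym (map-id xs))) (trans (filter-map P? Q? id agree xs) (map-id _))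

deduplicate-cong : {A : Set} {R S : A → A → Set} (R? : ∀ x y → Dec (R x y)) (S? : ∀ x y → Dec (S x y)) →
                   (∀ x y → does (S? x y) ≡ does (R? x y)) → ∀ xs → deduplicate S? xs ≡ deduplicate R? xs
deduplicate-cong R? S? agree xs =
  trans (cong (deduplicate S?) (sym (map-id xs))) (trans (deduplicate-map R? S? id agree xs) (map-id _))

filterᵇ-map : {A B : Set} (p : B → Bool) (f : A → B) (xs : List A) → filterᵇ p (map f xs) ≡ map f (filterᵇ (p ∘ f) xs)
filterᵇ-map p f = filter-map (T? ∘ p ∘ f) (T? ∘ p) f (λ _ → refl)

filterᵇ-upTo-suc : (p : ℕ → Bool) (n : ℕ) → filterᵇ p (upTo (suc n)) ≡ consIf (p 0) 0 (map suc (filterᵇ (p ∘ suc) (upTo n)))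
filterᵇ-upTo-suc p n = begin
  filterᵇ p (upTo (suc n))                            ≡⟨ cong (filterᵇ p) (upTo-suc n) ⟩
  filterᵇ p (0 ∷ map suc (upTo n))                    ≡⟨ filterᵇ-∷ p 0 _ ⟩
  consIf (p 0) 0 (filterᵇ p (map suc (upTo n)))       ≡⟨ cong (consIf (p 0) 0) (filterᵇ-map p suc (upTo n)) ⟩
  consIf (p 0) 0 (map suc (filterᵇ (p ∘ suc) (upTo n))) ∎
  where open ≡-Reasoning

allEqOn-∷ : ∀ x w i j → allEqOn (x ∷ w) (suc i) (suc j) ≡ allEqOn w i j
allEqOn-∷ x w i j = trans (cong and (sym (map-∘ (upTo (j ∸ i))))) (cong and (map-∘ (upTo (j ∸ i))))

nonDecreasing-∷ : ∀ x w i → nonDecreasing (x ∷ w) (suc i) ≡ nonDecreasing w i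
nonDecreasing-∷ x w i = cong ((i <ᵇ length w) ∧_) (begin
    any witness′ (upTo (suc (length w)))        ≡⟨ cong (any witness′) (upTo-suc (length w)) ⟩
    any witness′ (map suc (upTo (length w)))    ≡⟨ cong or (map-∘ (upTo (length w))) ⟨
    any (witness′ ∘ suc) (upTo (length w))      ≡⟨ cong or (map-cong shift (upTo (length w))) ⟩
    any witness (upTo (length w))               ∎)
  where
  open ≡-Reasoning
  witness′ witness : ℕ → Bool
  witness′ j = ((suc i + 1) ≤ᵇ j) ∧ (allEqOn (x ∷ w) (suc i) j ∧ (at (x ∷ w) (suc i) <ᵇ at (x ∷ w) j))
  witness  j = ((i + 1) ≤ᵇ j) ∧ (allEqOn w i j ∧ (at w i <ᵇ at w j))
  shift : ∀ j → witness′ (suc j) ≡ witness j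
  shift j = cong₂ _∧_ (≤ᵇ-suc (i + 1) j) (cong (_∧ (at w i <ᵇ at w j)) (allEqOn-∷ x w i j))

-- Locally minimal positions and unimodal factors of x ∷ w

valleyAfter : ℕ → List ℕ → Bool
valleyAfter x w = nonDecreasing w 0 ∧ (at w 0 <ᵇ x)

locallyMinimal-0 : ∀ w → locallyMinimal w 0 ≡ false
locallyMinimal-0 w = ∧-zeroʳ _

locallyMinimal-∷-1 : ∀ x w → locallyMinimal (x ∷ w) 1 ≡ valleyAfter x w
locallyMinimal-∷-1 x w = cong (_∧ (at w 0 <ᵇ x)) (nonDecreasing-∷ x w 0)

locallyMinimal-∷ : ∀ x w i → locallyMinimal (x ∷ w) (suc (suc i)) ≡ locallyMinimal w (suc i)
locallyMinimal-∷ x w i = cong (_∧ (at w (suc i) <ᵇ at w i)) (nonDecreasing-∷ x w (suc i))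

lmPositions-from-1 : ∀ y w → lmPositions (y ∷ w) ≡ map suc (filterᵇ (locallyMinimal (y ∷ w) ∘ suc) (upTo (length w)))
lmPositions-from-1 y w =
  trans (filterᵇ-upTo-suc lm (length w))
        (cong (λ b → consIf b 0 (map suc (filterᵇ (lm ∘ suc) (upTo (length w))))) (locallyMinimal-0 (y ∷ w)))
  where
  lm : ℕ → Bool
  lm = locallyMinimal (y ∷ w)

lmPositions-∷ : ∀ x w → lmPositions (x ∷ w) ≡ map suc (consIf (valleyAfter x w) 0 (lmPositions w))
lmPositions-∷ x []      = refl
lmPositions-∷ x (y ∷ w) = begin
    lmPositions (x ∷ y ∷ w)
  ≡⟨ lmPositions-from-1 x (y ∷ w) ⟩
    map suc (filterᵇ (lm ∘ suc) (upTo (suc (length w))))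
  ≡⟨ cong (map suc) (filterᵇ-upTo-suc (lm ∘ suc) (length w)) ⟩
    map suc (consIf (lm 1) 0 (map suc (filterᵇ (lm ∘ suc ∘ suc) (upTo (length w)))))
  ≡⟨ cong₂ (λ b ps → map suc (consIf b 0 (map suc ps))) (locallyMinimal-∷-1 x (y ∷ w))
           (filter-cong (T? ∘ locallyMinimal (y ∷ w) ∘ suc) (T? ∘ lm ∘ suc ∘ suc)
                        (locallyMinimal-∷ x (y ∷ w)) (upTo (length w))) ⟩
    map suc (consIf (valleyAfter x (y ∷ w)) 0 (map suc (filterᵇ (locallyMinimal (y ∷ w) ∘ suc) (upTo (length w)))))
  ≡⟨ cong (λ ps → map suc (consIf (valleyAfter x (y ∷ w)) 0 ps)) (sym (lmPositions-from-1 y w)) ⟩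
    map suc (consIf (valleyAfter x (y ∷ w)) 0 (lmPositions (y ∷ w)))
  ∎
  where
  open ≡-Reasoning
  lm : ℕ → Bool
  lm = locallyMinimal (x ∷ y ∷ w)

valleyAfter-≥ : ∀ x y r → x ≤ y → valleyAfter x (y ∷ r) ≡ false
valleyAfter-≥ x y r x≤y rewrite <ᵇ-false x≤y = ∧-zeroʳ _

valleyAfter-< : ∀ x y z r → y < z → y < x → valleyAfter x (y ∷ z ∷ r) ≡ true
valleyAfter-< x y z r y<z y<x rewrite ≡ᵇ-refl y | <ᵇ-true y<z | <ᵇ-true y<x = refl

bounds-map-suc : ∀ ps n → bounds (map suc ps) (suc n) ≡ map (Product.map suc suc) (bounds ps n)
bounds-map-suc []           n = refl
bounds-map-suc (i ∷ [])     n = refl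
bounds-map-suc (i ∷ j ∷ ps) n = cong ((suc i , suc j) ∷_) (bounds-map-suc (j ∷ ps) n)

firstBoundary : List ℕ → ℕ
firstBoundary w = fromMaybe (length w) (head (lmPositions w))

eis-∷ : ∀ x w → eis (x ∷ w) ≡ consIf (valleyAfter x w) (factor w 0 (firstBoundary w)) (eis w)
eis-∷ x w = begin
    map (uncurry (factor (x ∷ w))) (bounds (lmPositions (x ∷ w)) (suc (length w)))
  ≡⟨ cong (λ ps → map (uncurry (factor (x ∷ w))) (bounds ps (suc (length w)))) (lmPositions-∷ x w) ⟩
    map (uncurry (factor (x ∷ w))) (bounds (map suc ps) (suc (length w)))
  ≡⟨ cong (map (uncurry (factor (x ∷ w)))) (bounds-map-suc ps (length w)) ⟩
    map (uncurry (factor (x ∷ w))) (map (Product.map suc suc) (bounds ps (length w)))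
  ≡⟨ sym (map-∘ (bounds ps (length w))) ⟩
    map (uncurry (factor w)) (bounds ps (length w))
  ≡⟨ first-factor ⟩
    consIf (valleyAfter x w) (factor w 0 (firstBoundary w)) (eis w)
  ∎
  where
  open ≡-Reasoning
  ps : List ℕ
  ps = consIf (valleyAfter x w) 0 (lmPositions w)
  first-factor : map (uncurry (factor w)) (bounds ps (length w))
               ≡ consIf (valleyAfter x w) (factor w 0 (firstBoundary w)) (eis w)
  first-factor with valleyAfter x w
  ... | false = refl
  ... | true with lmPositions w
  ...   | []    = refl
  ...   | _ ∷ _ = refl

eis-∷-≤ : ∀ x y w → x ≤ y → eis (x ∷ y ∷ w) ≡ eis (y ∷ w)
eis-∷-≤ x y w x≤y rewrite eis-∷ x (y ∷ w) | valleyAfter-≥ x y w x≤y = refl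

firstBoundary-∷ : ∀ x w → valleyAfter x w ≡ false → firstBoundary (x ∷ w) ≡ suc (firstBoundary w)
firstBoundary-∷ x w no-valley rewrite lmPositions-∷ x w | no-valley with lmPositions w
... | []    = refl
... | _ ∷ _ = refl

-- Words made of blocks x y^(j+1)

record Block : Set where
  constructor block
  field
    base top run : ℕ

open Block

blockWord : Block → List ℕ
blockWord (block x y j) = x ∷ replicate (suc j) y

blocks : List Block → List ℕ
blocks = concatMap blockWord

StartsBelow : ℕ → List Block → Set
StartsBelow y []      = ⊤
StartsBelow y (b ∷ _) = base b < y

ValidBlocks : List Block → Set
ValidBlocks []       = ⊤
ValidBlocks (b ∷ bs) = base b < top b × StartsBelow (top b) bs × ValidBlocks bs

-- Letters are shifted by one as in ext; the factor of a block ends with the first letter of the next block, or $.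
blockFactors : List Block → List (List ℕ)
blockFactors []       = []
blockFactors (b ∷ bs) = (map suc (blockWord b) ++ take 1 (ext (blocks bs))) ∷ blockFactors bs

take-ext-++ : ∀ u r → take (suc (length u)) (ext (u ++ r)) ≡ map suc u ++ take 1 (ext r)
take-ext-++ []      r = refl
take-ext-++ (x ∷ u) r = cong (suc x ∷_) (take-ext-++ u r)

valleyAfter-blocks : ∀ q b bs → base b < q → ValidBlocks (b ∷ bs) → valleyAfter q (blocks (b ∷ bs)) ≡ true
valleyAfter-blocks q (block x y j) bs x<q (x<y , _) = valleyAfter-< q x y (replicate j y ++ blocks bs) x<y x<q

firstBoundary-plateau : ∀ y k bs → StartsBelow y bs → ValidBlocks bs →
                        firstBoundary (replicate (suc k) y ++ blocks bs) ≡ length (replicate (suc k) y)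
firstBoundary-plateau y zero    []       _   _ = refl
firstBoundary-plateau y zero    (b ∷ bs) b<y v
  rewrite lmPositions-∷ y (blocks (b ∷ bs)) | valleyAfter-blocks y b bs b<y v = refl
firstBoundary-plateau y (suc k) bs       b<y v =
  trans (firstBoundary-∷ y w (valleyAfter-≥ y y (replicate k y ++ blocks bs) ≤-refl))
        (cong suc (firstBoundary-plateau y k bs b<y v))
  where
  w : List ℕ
  w = replicate (suc k) y ++ blocks bs

firstBoundary-blocks : ∀ b bs → ValidBlocks (b ∷ bs) → firstBoundary (blocks (b ∷ bs)) ≡ length (blockWord b)
firstBoundary-blocks (block x y j) bs (x<y , y>bs , v) =
  trans (firstBoundary-∷ x w (valleyAfter-≥ x y (replicate j y ++ blocks bs) (<⇒≤ x<y)))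
        (cong suc (firstBoundary-plateau y j bs y>bs v))
  where
  w : List ℕ
  w = replicate (suc j) y ++ blocks bs

-- Inside a valid block word the locally minimal positions are exactly the bases of all blocks but the first.
mutual
  eis-∷-blocks : ∀ q b bs → base b < q → ValidBlocks (b ∷ bs) → eis (q ∷ blocks (b ∷ bs)) ≡ blockFactors (b ∷ bs)
  eis-∷-blocks q b bs b<q v
    rewrite eis-∷ q (blocks (b ∷ bs)) | valleyAfter-blocks q b bs b<q v | firstBoundary-blocks b bs v
          | take-ext-++ (blockWord b) (blocks bs) | eis-blocks b bs v = refl

  eis-blocks : ∀ b bs → ValidBlocks (b ∷ bs) → eis (blocks (b ∷ bs)) ≡ blockFactors bs
  eis-blocks (block x y j) bs (x<y , y>bs , v) =
    trans (eis-∷-≤ x y (replicate j y ++ blocks bs) (<⇒≤ x<y)) (eis-plateau y j bs y>bs v)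

  eis-plateau : ∀ y k bs → StartsBelow y bs → ValidBlocks bs → eis (replicate (suc k) y ++ blocks bs) ≡ blockFactors bs
  eis-plateau y zero    []       _   _ = refl
  eis-plateau y zero    (b ∷ bs) b<y v = eis-∷-blocks y b bs b<y v
  eis-plateau y (suc k) bs       b<y v =
    trans (eis-∷-≤ y y (replicate k y ++ blocks bs) ≤-refl) (eis-plateau y k bs b<y v)

-- Ranks of order-embedded factors

length-distinct-below : ∀ t b → (∀ c → c < b → c ∈ t) → length (deduplicateᵇ _≡ᵇ_ (filterᵇ (_<ᵇ b) t)) ≡ b
length-distinct-below t b covers = begin
    length (deduplicateᵇ _≡ᵇ_ (filterᵇ (_<ᵇ b) t))
  ≡⟨ cong length (deduplicate-cong _≟_ (λ x y → T? (x ≡ᵇ y)) (λ _ _ → refl) (filterᵇ (_<ᵇ b) t)) ⟩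
    length (deduplicate _≟_ (filterᵇ (_<ᵇ b) t))
  ≡⟨ cong (length ∘ deduplicate _≟_) (filter-cong (_<? b) (λ x → T? (x <ᵇ b)) (λ _ → refl) t) ⟩
    length distinct
  ≡⟨ ↭-length (∼bag⇒↭ (unique∧set⇒bag (deduplicate-! _) (upTo⁺ b) (mk⇔ to from))) ⟩
    length (upTo b)
  ≡⟨ length-upTo b ⟩
    b
  ∎
  where
  open ≡-Reasoning
  distinct : List ℕ
  distinct = deduplicate _≟_ (filter (_<? b) t)
  to : ∀ {c} → c ∈ distinct → c ∈ upTo b
  to c∈ = ∈-upTo⁺ (proj₂ (∈-filter⁻ (_<? b) {xs = t}
                              (Equivalence.from (deduplicate-∈⇔ _≟_ {xs = filter (_<? b) t}) c∈)))
  from : ∀ {c} → c ∈ upTo b → c ∈ distinct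
  from {c} c∈ = Equivalence.to (deduplicate-∈⇔ _≟_) (∈-filter⁺ (_<? b) (covers c (∈-upTo⁻ c∈)) (∈-upTo⁻ c∈))

module _ (code : ℕ → List ℕ) (final : List ℕ) (a : ℕ)
         (code-≡ : ∀ x y → eqᵇ (code x) (code y) ≡ (x ≡ᵇ y))
         (code-< : ∀ x y → lexLtᵇ (code x) (code y) ≡ (x <ᵇ y))
         (code<final : ∀ b → b < a → lexLtᵇ (code b) final ≡ true)
         (final≮code : ∀ b → b < a → lexLtᵇ final (code b) ≡ false)
         (final≮final : lexLtᵇ final final ≡ false)
         (t : List ℕ) (t<a : All (_< a) t) (covers : ∀ c → c < a → c ∈ t) where

  private
    us : List (List ℕ)
    us = map code t ++ final ∷ []

    rank-filter : ∀ u → lexLtᵇ final u ≡ false →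
                  rank us u ≡ length (deduplicateᵇ eqᵇ (filterᵇ (λ v → lexLtᵇ v u) (map code t)))
    rank-filter u final≮u = cong (λ vs → length (deduplicateᵇ eqᵇ vs)) (begin
        filterᵇ (λ v → lexLtᵇ v u) (map code t ++ final ∷ [])
      ≡⟨ filter-++ (T? ∘ λ v → lexLtᵇ v u) (map code t) (final ∷ []) ⟩
        filterᵇ (λ v → lexLtᵇ v u) (map code t) ++ filterᵇ (λ v → lexLtᵇ v u) (final ∷ [])
      ≡⟨ cong (filterᵇ (λ v → lexLtᵇ v u) (map code t) ++_)
              (trans (filterᵇ-∷ (λ v → lexLtᵇ v u) final []) (cong (λ b → consIf b final []) final≮u)) ⟩
        filterᵇ (λ v → lexLtᵇ v u) (map code t) ++ []
      ≡⟨ ++-identityʳ _ ⟩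
        filterᵇ (λ v → lexLtᵇ v u) (map code t)
      ∎)
      where open ≡-Reasoning

    length-deduplicate-codes : ∀ xs → length (deduplicateᵇ eqᵇ (map code xs)) ≡ length (deduplicateᵇ _≡ᵇ_ xs)
    length-deduplicate-codes xs =
      trans (cong length (deduplicate-map (λ x y → T? (x ≡ᵇ y)) (λ u v → T? (eqᵇ u v)) code code-≡ xs))
            (length-map code (deduplicateᵇ _≡ᵇ_ xs))

    rank-code : ∀ b → b < a → rank us (code b) ≡ b
    rank-code b b<a = begin
        rank us (code b)
      ≡⟨ rank-filter (code b) (final≮code b b<a) ⟩
        length (deduplicateᵇ eqᵇ (filterᵇ (λ v → lexLtᵇ v (code b)) (map code t)))
      ≡⟨ cong (length ∘ deduplicateᵇ eqᵇ)
              (filter-map (λ x → T? (x <ᵇ b)) (λ v → T? (lexLtᵇ v (code b))) code (λ x → code-< x b) t) ⟩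
        length (deduplicateᵇ eqᵇ (map code (filterᵇ (_<ᵇ b) t)))
      ≡⟨ length-deduplicate-codes (filterᵇ (_<ᵇ b) t) ⟩
        length (deduplicateᵇ _≡ᵇ_ (filterᵇ (_<ᵇ b) t))
      ≡⟨ length-distinct-below t b (λ c c<b → covers c (<-trans c<b b<a)) ⟩
        b
      ∎
      where open ≡-Reasoning

    rank-final : rank us final ≡ a
    rank-final = begin
        rank us final
      ≡⟨ rank-filter final final≮final ⟩
        length (deduplicateᵇ eqᵇ (filterᵇ (λ v → lexLtᵇ v final) (map code t)))
      ≡⟨ cong (length ∘ deduplicateᵇ eqᵇ) (filter-all (λ v → T? (lexLtᵇ v final)) codes<final) ⟩
        length (deduplicateᵇ eqᵇ (map code t))
      ≡⟨ length-deduplicate-codes t ⟩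
        length (deduplicateᵇ _≡ᵇ_ t)
      ≡⟨ cong (length ∘ deduplicateᵇ _≡ᵇ_) (sym (filter-all (λ x → T? (x <ᵇ a)) (All.map <⇒<ᵇ t<a))) ⟩
        length (deduplicateᵇ _≡ᵇ_ (filterᵇ (_<ᵇ a) t))
      ≡⟨ length-distinct-below t a covers ⟩
        a
      ∎
      where
      open ≡-Reasoning
      codes<final : All (λ v → T (lexLtᵇ v final)) (map code t)
      codes<final = All.map⁺ (All.map (λ {b} b<a → Equivalence.from T-≡ (code<final b b<a)) t<a)

  map-rank-codes : map (rank us) us ≡ t ++ a ∷ []
  map-rank-codes = begin
      map (rank us) (map code t ++ final ∷ [])
    ≡⟨ map-++ (rank us) (map code t) (final ∷ []) ⟩
      map (rank us) (map code t) ++ rank us final ∷ []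
    ≡⟨ cong₂ (λ vs r → vs ++ r ∷ []) ranks-codes rank-final ⟩
      t ++ a ∷ []
    ∎
    where
    open ≡-Reasoning
    ranks-codes : map (rank us) (map code t) ≡ t
    ranks-codes = trans (sym (map-∘ t)) (trans (map-cong-local (All.map (λ {b} → rank-code b) t<a)) (map-id t))

record MaxLast (u : List ℕ) (a : ℕ) : Set where
  field
    body   : List ℕ
    split  : u ≡ body ++ a ∷ []
    below  : All (_< a) body
    covers : ∀ c → c < a → c ∈ body

module BlockCoding (prefix : ℕ) (encode : ℕ → Block) (follower : ℕ → ℕ)
                   (base<top : ∀ c d → base (encode d) < top (encode c))
                   (base<prefix : ∀ c → base (encode c) < prefix) where

  code : ℕ → List ℕ
  code c = map suc (blockWord (encode c)) ++ suc (follower c) ∷ []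

  finalCode : ℕ → List ℕ
  finalCode a = map suc (blockWord (encode a)) ++ 0 ∷ []

  -- The factor of a letter ends with the base of the next block; for it to depend on the letter
  -- alone, that base must be a function of the letter.
  Follows : ℕ → ℕ → Set
  Follows c d = base (encode d) ≡ follower c

  blockFactors-encode : ∀ t a → Linked Follows (t ++ a ∷ []) →
                        blockFactors (map encode (t ++ a ∷ [])) ≡ map code t ++ finalCode a ∷ []
  blockFactors-encode []          a _                = refl
  blockFactors-encode (c ∷ [])    a (follows ∷ _)    =
    cong (λ x → (map suc (blockWord (encode c)) ++ suc x ∷ []) ∷ finalCode a ∷ []) follows
  blockFactors-encode (c ∷ d ∷ t) a (follows ∷ rest) =
    cong₂ (λ x fs → (map suc (blockWord (encode c)) ++ suc x ∷ []) ∷ fs) follows (blockFactors-encode (d ∷ t) a rest)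

  validBlocks-encode : ∀ t → ValidBlocks (map encode t)
  validBlocks-encode []          = tt
  validBlocks-encode (c ∷ [])    = base<top c c , tt , tt
  validBlocks-encode (c ∷ d ∷ t) = base<top c c , base<top c d , validBlocks-encode (d ∷ t)

  module _ (code-≡ : ∀ x y → eqᵇ (code x) (code y) ≡ (x ≡ᵇ y))
           (code-< : ∀ x y → lexLtᵇ (code x) (code y) ≡ (x <ᵇ y)) (a : ℕ)
           (code<final : ∀ b → b < a → lexLtᵇ (code b) (finalCode a) ≡ true)
           (final≮code : ∀ b → b < a → lexLtᵇ (finalCode a) (code b) ≡ false)
           (final≮final : lexLtᵇ (finalCode a) (finalCode a) ≡ false) where

    eis-encode : ∀ t → Linked Follows (t ++ a ∷ []) →
                 eis (prefix ∷ blocks (map encode (t ++ a ∷ []))) ≡ map code t ++ finalCode a ∷ []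
    eis-encode []      linked = eis-∷-blocks prefix (encode a) [] (base<prefix a) (validBlocks-encode (a ∷ []))
    eis-encode (c ∷ t) linked =
      trans (eis-∷-blocks prefix (encode c) (map encode (t ++ a ∷ [])) (base<prefix c) (validBlocks-encode (c ∷ t ++ a ∷ [])))
            (blockFactors-encode (c ∷ t) a linked)

    is-encode : ∀ {u} → MaxLast u a → Linked Follows u → is (prefix ∷ blocks (map encode u)) ≡ u
    is-encode record { body = t ; split = refl ; below = t<a ; covers = covers } linked rewrite eis-encode t linked =
      map-rank-codes code (finalCode a) a code-≡ code-< code<final final≮code final≮final t t<a covers

-- The tower and its ternary recoding

liftBlock : ℕ → Block
liftBlock c = block 0 (suc c) 0

lift : List ℕ → List ℕ
lift u = 1 ∷ blocks (map liftBlock u)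

module Lift = BlockCoding 1 liftBlock (λ _ → 0) (λ _ _ → s≤s z≤n) (λ _ → s≤s z≤n)

is-lift : ∀ {u a} → MaxLast u a → is (lift u) ≡ u
is-lift {u} {a} maxLast =
  Lift.is-encode (λ x y → ∧-identityʳ (x ≡ᵇ y)) (λ x y → ∨-∧-falseʳ (x <ᵇ y) (x ≡ᵇ y)) a
    code<final final≮code final≮final maxLast (linked u)
  where
  open Lift using (code; finalCode)
  code<final : ∀ b → b < a → lexLtᵇ (code b) (finalCode a) ≡ true
  code<final b b<a rewrite <ᵇ-true b<a = refl
  final≮code : ∀ b → b < a → lexLtᵇ (finalCode a) (code b) ≡ false
  final≮code b b<a rewrite <ᵇ-false (<⇒≤ b<a) | ≢⇒≡ᵇ-false (>⇒≢ b<a) = refl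
  final≮final : lexLtᵇ (finalCode a) (finalCode a) ≡ false
  final≮final rewrite <ᵇ-false (≤-refl {a}) | ≡ᵇ-refl a = refl
  linked : ∀ xs → Linked Lift.Follows xs
  linked []          = []
  linked (c ∷ [])    = [-]
  linked (c ∷ d ∷ t) = refl ∷ linked (d ∷ t)

plateau : ℕ → ℕ → List ℕ
plateau c u = map suc (replicate c 2) ++ u ∷ []

eqᵇ-plateau : ∀ {u v} → u < 3 → v < 3 → ∀ a b → eqᵇ (plateau a u) (plateau b v) ≡ (a ≡ᵇ b) ∧ (u ≡ᵇ v)
eqᵇ-plateau {u} {v} u<3 v<3 zero    zero    = ∧-identityʳ (u ≡ᵇ v)
eqᵇ-plateau {u} {v} u<3 v<3 zero    (suc b) rewrite ≢⇒≡ᵇ-false (<⇒≢ u<3) = refl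
eqᵇ-plateau {u} {v} u<3 v<3 (suc a) zero    rewrite ≢⇒≡ᵇ-false (>⇒≢ v<3) = refl
eqᵇ-plateau {u} {v} u<3 v<3 (suc a) (suc b) = eqᵇ-plateau u<3 v<3 a b

lexLtᵇ-plateau : ∀ {u v} → u < 3 → v < 3 → ∀ a b →
                 lexLtᵇ (plateau a u) (plateau b v) ≡ (a <ᵇ b) ∨ ((a ≡ᵇ b) ∧ (u <ᵇ v))
lexLtᵇ-plateau {u} {v} u<3 v<3 zero    zero    = ∨-∧-falseʳ (u <ᵇ v) (u ≡ᵇ v)
lexLtᵇ-plateau {u} {v} u<3 v<3 zero    (suc b) rewrite <ᵇ-true u<3 = refl
lexLtᵇ-plateau {u} {v} u<3 v<3 (suc a) zero    rewrite <ᵇ-false {3} (<⇒≤ v<3) | ≢⇒≡ᵇ-false (>⇒≢ v<3) = refl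
lexLtᵇ-plateau {u} {v} u<3 v<3 (suc a) (suc b) = lexLtᵇ-plateau u<3 v<3 a b

ternaryBlock : ℕ → Block
ternaryBlock zero    = block 0 2 0
ternaryBlock (suc c) = block 1 2 c

-- In a word lift s every 0 is followed by a positive letter and every positive letter by 0.
ternaryFollower : ℕ → ℕ
ternaryFollower zero    = 1
ternaryFollower (suc _) = 0

-- The second leading 2 starts no unimodal factor; it only pads the length to 5 · 2^n − 3.
ternary : List ℕ → List ℕ
ternary u = 2 ∷ 2 ∷ blocks (map ternaryBlock u)

ternaryBlock-base<2 : ∀ c → base (ternaryBlock c) < 2
ternaryBlock-base<2 zero    = s≤s z≤n
ternaryBlock-base<2 (suc c) = s≤s (s≤s z≤n)

ternaryBlock-top : ∀ c → top (ternaryBlock c) ≡ 2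
ternaryBlock-top zero    = refl
ternaryBlock-top (suc c) = refl

module Ternary = BlockCoding 2 ternaryBlock ternaryFollower
  (λ c d → subst (base (ternaryBlock d) <_) (sym (ternaryBlock-top c)) (ternaryBlock-base<2 d)) ternaryBlock-base<2

is-ternary : ∀ {u a} → MaxLast u a → Linked Ternary.Follows u → is (ternary u) ≡ u
is-ternary {u} {a} maxLast linked = begin
    is (2 ∷ 2 ∷ blocks (map ternaryBlock u))
  ≡⟨ cong (λ e → map (rank e) e) (eis-∷-≤ 2 2 _ ≤-refl) ⟩
    is (2 ∷ blocks (map ternaryBlock u))
  ≡⟨ Ternary.is-encode code-≡ code-< a code<final final≮code (final≮final a) maxLast linked ⟩
    u
  ∎
  where
  open ≡-Reasoning
  open Ternary using (code; finalCode)
  1<3 : 1 < 3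
  1<3 = s≤s (s≤s z≤n)
  0<3 : 0 < 3
  0<3 = s≤s z≤n
  code-≡ : ∀ x y → eqᵇ (code x) (code y) ≡ (x ≡ᵇ y)
  code-≡ zero    zero    = refl
  code-≡ zero    (suc y) = refl
  code-≡ (suc x) zero    = refl
  code-≡ (suc x) (suc y) = trans (eqᵇ-plateau 1<3 1<3 x y) (∧-identityʳ (x ≡ᵇ y))
  code-< : ∀ x y → lexLtᵇ (code x) (code y) ≡ (x <ᵇ y)
  code-< zero    zero    = refl
  code-< zero    (suc y) = refl
  code-< (suc x) zero    = refl
  code-< (suc x) (suc y) = trans (lexLtᵇ-plateau 1<3 1<3 x y) (∨-∧-falseʳ (x <ᵇ y) (x ≡ᵇ y))
  code<final : ∀ {a} b → b < a → lexLtᵇ (code b) (finalCode a) ≡ true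
  code<final         zero    (s≤s _)   = refl
  code<final {suc a} (suc b) (s≤s b<a) rewrite lexLtᵇ-plateau 1<3 0<3 b a | <ᵇ-true b<a = refl
  final≮code : ∀ {a} b → b < a → lexLtᵇ (finalCode a) (code b) ≡ false
  final≮code         zero    (s≤s _)   = refl
  final≮code {suc a} (suc b) (s≤s b<a)
    rewrite lexLtᵇ-plateau 0<3 1<3 a b | <ᵇ-false (<⇒≤ b<a) | ≢⇒≡ᵇ-false (>⇒≢ b<a) = refl
  final≮final : ∀ a → lexLtᵇ (finalCode a) (finalCode a) ≡ false
  final≮final zero    = refl
  final≮final (suc a) rewrite lexLtᵇ-plateau 0<3 0<3 a a | ∨-∧-falseʳ (a <ᵇ a) (a ≡ᵇ a) = <ᵇ-false (≤-refl {a})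

linked-lift : ∀ s → Linked Ternary.Follows (lift s)
linked-lift = linked-from 0
  where
  linked-from : ∀ c s → Linked Ternary.Follows (suc c ∷ blocks (map liftBlock s))
  linked-from c []      = [-]
  linked-from c (d ∷ s) = refl ∷ refl ∷ linked-from d s

blocks-lift-below : ∀ {a t} → All (_< a) t → All (_< suc a) (blocks (map liftBlock t))
blocks-lift-below []           = []
blocks-lift-below (c<a ∷ t<a) = s≤s z≤n ∷ s≤s c<a ∷ blocks-lift-below t<a

∈-blocks-lift : ∀ {c t} → c ∈ t → suc c ∈ blocks (map liftBlock t)
∈-blocks-lift (here refl) = there (here refl)
∈-blocks-lift (there c∈t) = there (there (∈-blocks-lift c∈t))

lift-maxLast : ∀ {u a} → MaxLast u (suc a) → MaxLast (lift u) (suc (suc a))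
lift-maxLast {a = a} record { body = t ; split = refl ; below = t<a ; covers = covers } = record
  { body   = 1 ∷ blocks (map liftBlock t) ++ 0 ∷ []
  ; split  = cong (1 ∷_) (begin
        blocks (map liftBlock (t ++ suc a ∷ []))
      ≡⟨ cong blocks (map-++ liftBlock t (suc a ∷ [])) ⟩
        blocks (map liftBlock t ++ liftBlock (suc a) ∷ [])
      ≡⟨ concatMap-++ blockWord (map liftBlock t) (liftBlock (suc a) ∷ []) ⟩
        blocks (map liftBlock t) ++ 0 ∷ suc (suc a) ∷ []
      ≡⟨ ++-assoc (blocks (map liftBlock t)) (0 ∷ []) (suc (suc a) ∷ []) ⟨
        (blocks (map liftBlock t) ++ 0 ∷ []) ++ suc (suc a) ∷ []
      ∎)
  ; below  = s≤s (s≤s z≤n) ∷ All.++⁺ (blocks-lift-below t<a) (s≤s z≤n ∷ [])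
  ; covers = covers′
  }
  where
  open ≡-Reasoning
  covers′ : ∀ c → c < suc (suc a) → c ∈ 1 ∷ blocks (map liftBlock t) ++ 0 ∷ []
  covers′ zero    _         = there (∈-++⁺ʳ (blocks (map liftBlock t)) (here refl))
  covers′ (suc c) (s≤s c<a) = there (∈-++⁺ˡ (∈-blocks-lift (covers c c<a)))

tower : ℕ → List ℕ
tower zero    = 0 ∷ 0 ∷ 1 ∷ []
tower (suc m) = lift (tower m)

tower-maxLast : ∀ m → MaxLast (tower m) (suc m)
tower-maxLast zero    = record { body = 0 ∷ 0 ∷ [] ; split = refl ; below = s≤s z≤n ∷ s≤s z≤n ∷ [] ; covers = covers }
  where
  covers : ∀ c → c < 1 → c ∈ 0 ∷ 0 ∷ []
  covers zero    _         = here refl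
  covers (suc c) (s≤s ())
tower-maxLast (suc m) = lift-maxLast (tower-maxLast m)

is-tower : ∀ m → is (tower (suc m)) ≡ tower m
is-tower m = is-lift (tower-maxLast m)

is-ternary-tower : ∀ m → is (ternary (tower (suc m))) ≡ tower (suc m)
is-ternary-tower m = is-ternary (tower-maxLast (suc m)) (linked-lift (tower m))

is^-suc : ∀ k w → is^ (suc k) w ≡ is^ k (is w)
is^-suc zero    w = refl
is^-suc (suc k) w = cong is (is^-suc k w)

is^-tower : ∀ j m → is^ j (tower (j + m)) ≡ tower m
is^-tower zero    m = refl
is^-tower (suc j) m = begin
    is (is^ j (tower (suc (j + m))))   ≡⟨ cong (is ∘ is^ j ∘ tower) (+-suc j m) ⟨
    is (is^ j (tower (j + suc m)))     ≡⟨ cong is (is^-tower j (suc m)) ⟩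
    is (tower (suc m))                 ≡⟨ is-tower m ⟩
    tower m                            ∎
  where open ≡-Reasoning

is^-ternary-tower : ∀ {j m} → j ≤ suc m → is^ (suc j) (ternary (tower (suc m))) ≡ tower (suc m ∸ j)
is^-ternary-tower {j} {m} j≤1+m = begin
    is^ (suc j) (ternary (tower (suc m)))   ≡⟨ is^-suc j (ternary (tower (suc m))) ⟩
    is^ j (is (ternary (tower (suc m))))    ≡⟨ cong (is^ j) (is-ternary-tower m) ⟩
    is^ j (tower (suc m))                   ≡⟨ cong (is^ j ∘ tower) (m+[n∸m]≡n j≤1+m) ⟨
    is^ j (tower (j + (suc m ∸ j)))         ≡⟨ is^-tower j (suc m ∸ j) ⟩
    tower (suc m ∸ j)                       ∎
  where open ≡-Reasoning

lift-not-unique : ∀ c d r → ¬ Unique (lift (c ∷ d ∷ r))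
lift-not-unique c d r (_ ∷ (_ ∷ 0≢0 ∷ _) ∷ _) = 0≢0 refl

tower-∷∷ : ∀ m → ∃ λ c → ∃ λ d → ∃ λ r → tower m ≡ c ∷ d ∷ r
tower-∷∷ zero    = 0 , 0 , 1 ∷ [] , refl
tower-∷∷ (suc m) with tower-∷∷ m
... | c , d , r , eq rewrite eq = 1 , 0 , _ , refl

tower-not-unique : ∀ m → ¬ Unique (tower m)
tower-not-unique zero    ((0≢0 ∷ _) ∷ _) = 0≢0 refl
tower-not-unique (suc m) with tower-∷∷ m
... | c , d , r , eq rewrite eq = lift-not-unique c d r

ternary-letters : ∀ u → All (_< 3) (ternary u)
ternary-letters u = 2<3 ∷ 2<3 ∷ blocks-letters u
  where
  2<3 : 2 < 3
  2<3 = s≤s (s≤s (s≤s z≤n))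
  blocks-letters : ∀ u → All (_< 3) (blocks (map ternaryBlock u))
  blocks-letters []          = []
  blocks-letters (zero ∷ u)  = s≤s z≤n ∷ 2<3 ∷ blocks-letters u
  blocks-letters (suc c ∷ u) = s≤s (s≤s z≤n) ∷ All.++⁺ (All.replicate⁺ (suc c) 2<3) (blocks-letters u)

length-blocks-lift : ∀ u → length (blocks (map liftBlock u)) ≡ 2 * length u
length-blocks-lift []      = refl
length-blocks-lift (c ∷ u) = trans (cong (2 +_) (length-blocks-lift u)) (sym (*-suc 2 (length u)))

sum-blocks-lift : ∀ u → sum (blocks (map liftBlock u)) ≡ length u + sum u
sum-blocks-lift []      = refl
sum-blocks-lift (c ∷ u) = trans (cong (suc c +_) (sum-blocks-lift u)) (rearrange c (length u) (sum u))
  where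
  rearrange : ∀ c l s → suc c + (l + s) ≡ suc l + (c + s)
  rearrange = solve-∀

length-blocks-ternary-lift : ∀ s → length (blocks (map ternaryBlock (blocks (map liftBlock s)))) ≡ 4 * length s + sum s
length-blocks-ternary-lift []      = refl
length-blocks-ternary-lift (c ∷ s) = begin
    3 + length (replicate (suc c) 2 ++ rest)
  ≡⟨ cong (3 +_) (length-++ (replicate (suc c) 2)) ⟩
    3 + (length (replicate (suc c) 2) + length rest)
  ≡⟨ cong₂ (λ r l → 3 + (r + l)) (length-replicate (suc c)) (length-blocks-ternary-lift s) ⟩
    3 + (suc c + (4 * length s + sum s))
  ≡⟨ rearrange c (length s) (sum s) ⟩
    4 * suc (length s) + (c + sum s)
  ∎
  where
  open ≡-Reasoning
  rest : List ℕ
  rest = blocks (map ternaryBlock (blocks (map liftBlock s)))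
  rearrange : ∀ c l s → 3 + (suc c + (4 * l + s)) ≡ 4 * suc l + (c + s)
  rearrange = solve-∀

length-tower : ∀ m → length (tower m) + 1 ≡ 2 ^ (2 + m)
length-tower zero    = refl
length-tower (suc m) = begin
    suc (length (blocks (map liftBlock (tower m)))) + 1   ≡⟨ cong (λ l → suc l + 1) (length-blocks-lift (tower m)) ⟩
    suc (2 * length (tower m)) + 1                        ≡⟨ double (length (tower m)) ⟩
    2 * (length (tower m) + 1)                            ≡⟨ cong (2 *_) (length-tower m) ⟩
    2 ^ (3 + m)                                           ∎
  where
  open ≡-Reasoning
  double : ∀ l → suc (2 * l) + 1 ≡ 2 * (l + 1)
  double = solve-∀

sum-tower : ∀ m → sum (tower m) + 3 ≡ 2 ^ (2 + m)
sum-tower zero    = refl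
sum-tower (suc m) = begin
    suc (sum (blocks (map liftBlock (tower m)))) + 3          ≡⟨ cong (λ s → suc s + 3) (sum-blocks-lift (tower m)) ⟩
    suc (length (tower m) + sum (tower m)) + 3                ≡⟨ regroup (length (tower m)) (sum (tower m)) ⟩
    (length (tower m) + 1) + (sum (tower m) + 3)              ≡⟨ cong₂ _+_ (length-tower m) (sum-tower m) ⟩
    2 ^ (2 + m) + 2 ^ (2 + m)                                 ≡⟨ double (2 ^ (2 + m)) ⟩
    2 ^ (3 + m)                                               ∎
  where
  open ≡-Reasoning
  regroup : ∀ l s → suc (l + s) + 3 ≡ (l + 1) + (s + 3)
  regroup = solve-∀
  double : ∀ x → x + x ≡ 2 * x
  double = solve-∀

length-ternary-tower : ∀ m → length (ternary (tower (suc m))) + 3 ≡ 5 * 2 ^ (2 + m)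
length-ternary-tower m = begin
    4 + length (blocks (map ternaryBlock (blocks (map liftBlock (tower m))))) + 3
  ≡⟨ cong (λ l → 4 + l + 3) (length-blocks-ternary-lift (tower m)) ⟩
    4 + (4 * length (tower m) + sum (tower m)) + 3
  ≡⟨ regroup (length (tower m)) (sum (tower m)) ⟩
    4 * (length (tower m) + 1) + (sum (tower m) + 3)
  ≡⟨ cong₂ (λ l s → 4 * l + s) (length-tower m) (sum-tower m) ⟩
    4 * 2 ^ (2 + m) + 2 ^ (2 + m)
  ≡⟨ five (2 ^ (2 + m)) ⟩
    5 * 2 ^ (2 + m)
  ∎
  where
  open ≡-Reasoning
  regroup : ∀ l s → 4 + (4 * l + s) + 3 ≡ 4 * (l + 1) + (s + 3)
  regroup = solve-∀
  five : ∀ x → 4 * x + x ≡ 5 * x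
  five = solve-∀

5*2^[1+j]*2^[2+m∸j] : ∀ {j m} → j ≤ m → 5 * 2 ^ suc j * 2 ^ (2 + (m ∸ j)) ≡ 4 * (5 * 2 ^ (1 + m))
5*2^[1+j]*2^[2+m∸j] {j} {m} j≤m = begin
    5 * 2 ^ suc j * 2 ^ (2 + (m ∸ j))     ≡⟨ *-assoc 5 (2 ^ suc j) (2 ^ (2 + (m ∸ j))) ⟩
    5 * (2 ^ suc j * 2 ^ (2 + (m ∸ j)))   ≡⟨ cong (5 *_) (^-distribˡ-+-* 2 (suc j) (2 + (m ∸ j))) ⟨
    5 * 2 ^ (suc j + (2 + (m ∸ j)))       ≡⟨ cong (λ e → 5 * 2 ^ e) (exponent j (m ∸ j)) ⟩
    5 * 2 ^ (3 + (j + (m ∸ j)))           ≡⟨ cong (λ e → 5 * 2 ^ (3 + e)) (m+[n∸m]≡n j≤m) ⟩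
    5 * 2 ^ (3 + m)                       ≡⟨ quadruple (2 ^ (1 + m)) ⟩
    4 * (5 * 2 ^ (1 + m))                 ∎
  where
  open ≡-Reasoning
  exponent : ∀ j d → suc j + (2 + d) ≡ 3 + (j + d)
  exponent = solve-∀
  quadruple : ∀ x → 5 * (2 * (2 * x)) ≡ 4 * (5 * x)
  quadruple = solve-∀

corollary6 : (n : ℕ) → 3 ≤ n →
    Σ (List ℕ) λ w →
      All (_< 3) w
      × length w ≡ 5 * 2 ^ n ∸ 3
      × ISRecursiveCalls w n
      × (∀ k → 1 ≤ k → k ≤ n →
           5 * 2 ^ k * (length (is^ k w) + 1) ≡ 4 * (length w + 3))
corollary6 zero          ()
corollary6 (suc zero)    (s≤s ())
corollary6 (suc (suc p)) _ = w , ternary-letters (tower (suc p)) , length-w , (last-unique , earlier-repeat) , lengths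
  where
  open ≡-Reasoning
  w : List ℕ
  w = ternary (tower (suc p))
  length-w : length w ≡ 5 * 2 ^ (2 + p) ∸ 3
  length-w = trans (sym (m+n∸n≡m (length w) 3)) (cong (_∸ 3) (length-ternary-tower p))
  last-unique : Unique (is^ (3 + p) w)
  last-unique = subst Unique (sym (cong is (trans (is^-ternary-tower (≤-refl {suc p})) (cong tower (n∸n≡0 (suc p)))))) []
  earlier-repeat : ∀ k → k < 2 + p → ¬ Unique (is^ (suc k) w)
  earlier-repeat k (s≤s k≤1+p) = tower-not-unique (suc p ∸ k) ∘ subst Unique (is^-ternary-tower k≤1+p)
  lengths : ∀ k → 1 ≤ k → k ≤ 2 + p → 5 * 2 ^ k * (length (is^ k w) + 1) ≡ 4 * (length w + 3)
  lengths (suc j) _ (s≤s j≤1+p) = begin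
      5 * 2 ^ suc j * (length (is^ (suc j) w) + 1)        ≡⟨ cong (λ v → 5 * 2 ^ suc j * (length v + 1)) is^-w ⟩
      5 * 2 ^ suc j * (length (tower (suc p ∸ j)) + 1)    ≡⟨ cong (5 * 2 ^ suc j *_) (length-tower (suc p ∸ j)) ⟩
      5 * 2 ^ suc j * 2 ^ (2 + (suc p ∸ j))               ≡⟨ 5*2^[1+j]*2^[2+m∸j] j≤1+p ⟩
      4 * (5 * 2 ^ (2 + p))                               ≡⟨ cong (4 *_) (length-ternary-tower p) ⟨
      4 * (length w + 3)                                  ∎
    where
    is^-w : is^ (suc j) w ≡ tower (suc p ∸ j)
    is^-w = is^-ternary-tower j≤1+p
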